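{- Let $n,\ell$ be positive integers, $\mathcal{N}=\{1,\ldots,n\}$, and $m_1,\dots,m_\ell\in\{0,\dots,n\}$. For $1\le i\le\ell$ choose $A_i$ independently and uniformly at random from the set of all $m_i$-element subsets of $\mathcal{N}$. Let $X_n=|\bigcup_{i=1}^{\ell} A_i|$ and $Y_n=n-X_n$. Then for every integer $k\ge0$, $${\mathbb E}((Y_n)_k)=(n)_k\prod_{j=1}^\ell \frac{(n-m_j)_k}{(n)_k},$$ for $0\le k\le n$, $${\mathbb P}(Y_n=k)=\sum_{h=k}^n(-1)^{h-k}{h \choose k}{n\choose h}\prod_{j=1}^\ell \frac{(n- m_j)_h}{(n)_h},$$ and for $0\le i\le n$, $${\mathbb P}(X_n=i)={n\choose i}\sum_{h=0}^{i}(-1)^h{i\choose h}\prod_{j=1}^\ell \frac{ {i-h \choose m_j}}{{n \choose m_j}}.$$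
   Context: $(m)_k=m(m-1)\cdots(m-k+1)$ denotes the falling factorial, for integers and for random variables. -}

module Defs where

open import Data.Nat using (ℕ; zero; suc; _≟_; _∸_) renaming (_+_ to ℕ+)
open import Data.Nat.Combinatorics using (_P_)
open import Data.Integer using (+_)
open import Data.Rational using (ℚ; 0ℚ; 1ℚ; _+_; _*_; -_; _/_)
open import Data.Bool using (Bool; true; false; if_then_else_)
open import Data.List using (List; []; _∷_; [_]; map; concatMap; filter; foldr; length; upTo)
open import Data.Vec using (Vec; []; _∷_; toList)
open import Data.Fin.Subset using (Subset; ∣_∣; ⋃; inside; outside)
open import Relation.Nullary.Decidable using (⌊_⌋)

-- falling factorial (m)_k = m(m-1)...(m-k+1)  (stdlib's _P_, which is 0 for k > m)
ff : ℕ → ℕ → ℕ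
ff m k = m P k

allSubsets : (n : ℕ) → List (Subset n)
allSubsets zero    = [ [] ]
allSubsets (suc n) = concatMap (λ s → (inside ∷ s) ∷ (outside ∷ s) ∷ []) (allSubsets n)

kSubsets : (n m : ℕ) → List (Subset n)
kSubsets n m = filter (λ s → ∣ s ∣ ≟ m) (allSubsets n)

-- sample space of (A_1,...,A_ℓ), A_i an m_i-subset; the independent uniform
-- choice is the uniform distribution on this (product) list
outcomes : (n : ℕ) {ℓ : ℕ} → Vec ℕ ℓ → List (Vec (Subset n) ℓ)
outcomes n []       = [ [] ]
outcomes n (m ∷ ms) = concatMap (λ A → map (A ∷_) (outcomes n ms)) (kSubsets n m)

-- rational a/b with the convention a/0 = 0
frac : ℕ → ℕ → ℚ
frac a zero    = 0ℚ
frac a (suc b) = (+ a) / suc b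

nat : ℕ → ℚ
nat a = frac a 1

sumℚ : List ℚ → ℚ
sumℚ = foldr _+_ 0ℚ

prodℚ : List ℚ → ℚ
prodℚ = foldr _*_ 1ℚ

negOnePow : ℕ → ℚ
negOnePow zero    = 1ℚ
negOnePow (suc k) = - negOnePow k

sumFromTo : ℕ → ℕ → (ℕ → ℚ) → ℚ
sumFromTo a b f = sumℚ (map (λ i → f (ℕ+ a i)) (upTo (suc b ∸ a)))

E : {Ω : Set} → List Ω → (Ω → ℕ) → ℚ
E Ω f = frac (foldr ℕ+ 0 (map f Ω)) (length Ω)

Pr= : {Ω : Set} → List Ω → (Ω → ℕ) → ℕ → ℚ
Pr= Ω f k = frac (length (filter (λ ω → f ω ≟ k) Ω)) (length Ω)

Xvar : {n ℓ : ℕ} → Vec (Subset n) ℓ → ℕ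
Xvar As = ∣ ⋃ (toList As) ∣

Yvar : {n ℓ : ℕ} → Vec (Subset n) ℓ → ℕ
Yvar {n} As = n ∸ Xvar As

-- Y = n − X counts the points of 𝒩 outside every A_j, so C(Y,h) counts the h-subsets T of 𝒩
-- that are disjoint from A_1 ∪ … ∪ A_ℓ. Summing over the outcomes first, for a fixed T each A_j
-- avoids T in C(n−h,m_j) of its C(n,m_j) choices, whence
--   E C(Y,h) = C(n,h) ∏_j C(n−h,m_j) / C(n,m_j),
-- and (Y)_k = k! C(Y,k) together with C(n−k,m)/C(n,m) = (n−m)_k/(n)_k gives the factorial moments.
-- The law of Y follows from the binomial moments by the inversion
--   [y = k] = Σ_{h ≥ k} (−1)^(h−k) C(h,k) C(y,h),
-- which holds because C(h,k) C(y,h) = C(y,k) C(y−k,h−k) and Σ_t (−1)^t C(a,t) = [a = 0].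
-- The law of X is that of Y at k = n − i, rewritten with C(h,n−i) C(n,h) = C(n,i) C(i,h−n+i).
module Submission where

open import Defs
open import Algebra.Bundles using (CommutativeSemiring; CommutativeRing)
open import Data.Bool using (true; false; if_then_else_)
open import Data.List using (List; []; _∷_; _++_; map; concatMap; filter; foldr; length)
open import Data.List.Relation.Unary.All using (All; []; _∷_)
open import Level using (Level)
open import Relation.Nullary using (does)
open import Relation.Unary using (Pred; Decidable)

module ListSum {c ℓ} (R : CommutativeSemiring c ℓ) where

  open CommutativeSemiring R
  open import Relation.Binary.Reasoning.Setoid setoid
  open import Algebra.Properties.CommutativeSemigroup +-commutativeSemigroup using (interchange)

  private variable
    a b : Level
    A B : Set a

  -- The fold used by sumℚ and E in Defs, so that both unfold to ∑ definitionally.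
  ∑ : List A → (A → Carrier) → Carrier
  ∑ xs f = foldr _+_ 0# (map f xs)

  ∑-cong : ∀ (xs : List A) {f g : A → Carrier} → (∀ x → f x ≈ g x) → ∑ xs f ≈ ∑ xs g
  ∑-cong []       f≈g = refl
  ∑-cong (x ∷ xs) f≈g = +-cong (f≈g x) (∑-cong xs f≈g)

  ∑-cong-All : ∀ {xs : List A} {f g : A → Carrier} → All (λ x → f x ≈ g x) xs → ∑ xs f ≈ ∑ xs g
  ∑-cong-All []            = refl
  ∑-cong-All (fx≈gx ∷ eqs) = +-cong fx≈gx (∑-cong-All eqs)

  ∑-zero : ∀ (xs : List A) → ∑ xs (λ _ → 0#) ≈ 0#
  ∑-zero []       = refl
  ∑-zero (x ∷ xs) = trans (+-identityˡ _) (∑-zero xs)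

  ∑-++ : ∀ (xs ys : List A) f → ∑ (xs ++ ys) f ≈ ∑ xs f + ∑ ys f
  ∑-++ []       ys f = sym (+-identityˡ _)
  ∑-++ (x ∷ xs) ys f = trans (+-congˡ (∑-++ xs ys f)) (sym (+-assoc _ _ _))

  ∑-map : ∀ (g : A → B) xs f → ∑ (map g xs) f ≈ ∑ xs (λ x → f (g x))
  ∑-map g []       f = refl
  ∑-map g (x ∷ xs) f = +-congˡ (∑-map g xs f)

  ∑-concatMap : ∀ (g : A → List B) xs f → ∑ (concatMap g xs) f ≈ ∑ xs (λ x → ∑ (g x) f)
  ∑-concatMap g []       f = refl
  ∑-concatMap g (x ∷ xs) f = trans (∑-++ (g x) (concatMap g xs) f) (+-congˡ (∑-concatMap g xs f))

  ∑-distrib-+ : ∀ (xs : List A) f g → ∑ xs (λ x → f x + g x) ≈ ∑ xs f + ∑ xs g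
  ∑-distrib-+ []       f g = sym (+-identityˡ 0#)
  ∑-distrib-+ (x ∷ xs) f g = trans (+-congˡ (∑-distrib-+ xs f g)) (interchange _ _ _ _)

  *-distribˡ-∑ : ∀ c (xs : List A) f → c * ∑ xs f ≈ ∑ xs (λ x → c * f x)
  *-distribˡ-∑ c []       f = zeroʳ c
  *-distribˡ-∑ c (x ∷ xs) f = trans (distribˡ c _ _) (+-congˡ (*-distribˡ-∑ c xs f))

  *-distribʳ-∑ : ∀ c (xs : List A) f → ∑ xs f * c ≈ ∑ xs (λ x → f x * c)
  *-distribʳ-∑ c xs f = begin
    ∑ xs f * c             ≈⟨ *-comm _ c ⟩
    c * ∑ xs f             ≈⟨ *-distribˡ-∑ c xs f ⟩
    ∑ xs (λ x → c * f x)   ≈⟨ ∑-cong xs (λ x → *-comm c (f x)) ⟩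
    ∑ xs (λ x → f x * c)   ∎

  ∑-comm : ∀ (xs : List A) (ys : List B) (f : A → B → Carrier) →
           ∑ xs (λ x → ∑ ys (f x)) ≈ ∑ ys (λ y → ∑ xs (λ x → f x y))
  ∑-comm []       ys f = sym (∑-zero ys)
  ∑-comm (x ∷ xs) ys f = begin
    ∑ ys (f x) + ∑ xs (λ x → ∑ ys (f x))           ≈⟨ +-congˡ (∑-comm xs ys f) ⟩
    ∑ ys (f x) + ∑ ys (λ y → ∑ xs (λ x → f x y))   ≈⟨ ∑-distrib-+ ys (f x) _ ⟨
    ∑ ys (λ y → f x y + ∑ xs (λ x → f x y))        ∎

  ∑-filter : ∀ {P : Pred A b} (P? : Decidable P) xs f →
             ∑ (filter P? xs) f ≈ ∑ xs (λ x → if does (P? x) then f x else 0#)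
  ∑-filter P? []       f = refl
  ∑-filter P? (x ∷ xs) f with does (P? x)
  ... | true  = +-congˡ (∑-filter P? xs f)
  ... | false = trans (∑-filter P? xs f) (sym (+-identityˡ _))

import Data.Nat.Properties as ℕ
import Data.Rational.Properties as ℚ

module ∑ℕ = ListSum ℕ.+-*-commutativeSemiring
module ∑ℚ = ListSum (CommutativeRing.commutativeSemiring ℚ.+-*-commutativeRing)

module Binomial where

  open import Data.Nat
  open import Data.Nat.Properties
  open import Data.Nat.Combinatorics using (_C_; _P_; nCk≡nC[n∸k]; k![n∸k]!∣n!)
  open import Data.Nat.Combinatorics.Specification
    using (nCk≡n!/k![n-k]!; k>n⇒nCk≡0; nPk≡n!/[n∸k]!; k>n⇒nPk≡0)
  open import Data.Nat.DivMod using (m/n*n≡m)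
  open import Data.Nat.Divisibility using (m≤n⇒m!∣n!)
  open import Data.Nat.Tactic.RingSolver using (solve-∀)
  open import Data.Sum using (inj₁; inj₂)
  open import Relation.Binary.PropositionalEquality
  open ≡-Reasoning

  nCk*k![n∸k]!≡n! : ∀ {n k} → k ≤ n → (n C k) * (k ! * (n ∸ k) !) ≡ n !
  nCk*k![n∸k]!≡n! {n} {k} k≤n = begin
    (n C k) * (k ! * (n ∸ k) !)                   ≡⟨ cong (_* (k ! * (n ∸ k) !)) (nCk≡n!/k![n-k]! k≤n) ⟩
    n ! / (k ! * (n ∸ k) !) * (k ! * (n ∸ k) !)   ≡⟨ m/n*n≡m (k![n∸k]!∣n! k≤n) ⟩
    n !                                           ∎
    where instance _ = k !* (n ∸ k) !≢0

  [k+r]Ck*k!r!≡[k+r]! : ∀ k r → ((k + r) C k) * (k ! * r !) ≡ (k + r) !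
  [k+r]Ck*k!r!≡[k+r]! k r =
    subst (λ s → ((k + r) C k) * (k ! * s !) ≡ (k + r) !) (m+n∸m≡n k r) (nCk*k![n∸k]!≡n! (m≤m+n k r))

  nPk*[n∸k]!≡n! : ∀ {n k} → k ≤ n → (n P k) * (n ∸ k) ! ≡ n !
  nPk*[n∸k]!≡n! {n} {k} k≤n = begin
    (n P k) * (n ∸ k) !           ≡⟨ cong (_* (n ∸ k) !) (nPk≡n!/[n∸k]! k≤n) ⟩
    n ! / (n ∸ k) ! * (n ∸ k) !   ≡⟨ m/n*n≡m (m≤n⇒m!∣n! (m∸n≤m n k)) ⟩
    n !                           ∎
    where instance _ = (n ∸ k) !≢0

  nPk≡k!*nCk : ∀ n k → n P k ≡ k ! * (n C k)
  nPk≡k!*nCk n k with ≤-<-connex k n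
  ... | inj₂ n<k = begin
    n P k           ≡⟨ k>n⇒nPk≡0 n<k ⟩
    0               ≡⟨ *-zeroʳ (k !) ⟨
    k ! * 0         ≡⟨ cong (k ! *_) (k>n⇒nCk≡0 n<k) ⟨
    k ! * (n C k)   ∎
  ... | inj₁ k≤n = *-cancelʳ-≡ _ _ ((n ∸ k) !) {{(n ∸ k) !≢0}} (begin
    (n P k) * (n ∸ k) !           ≡⟨ nPk*[n∸k]!≡n! k≤n ⟩
    n !                           ≡⟨ nCk*k![n∸k]!≡n! k≤n ⟨
    (n C k) * (k ! * (n ∸ k) !)   ≡⟨ rearrange (n C k) (k !) ((n ∸ k) !) ⟩
    k ! * (n C k) * (n ∸ k) !     ∎)
    where
    rearrange : ∀ c x y → c * (x * y) ≡ x * c * y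
    rearrange = solve-∀

  nCk≢0 : ∀ {n k} → k ≤ n → NonZero (n C k)
  nCk≢0 {n} {k} k≤n = m*n≢0⇒m≢0 (n C k) {{subst NonZero (sym (nCk*k![n∸k]!≡n! k≤n)) (n !≢0)}}

  nPk≢0 : ∀ {n k} → k ≤ n → NonZero (n P k)
  nPk≢0 {n} {k} k≤n =
    subst NonZero (sym (nPk≡k!*nCk n k)) (m*n≢0 (k !) (n C k) {{k !≢0}} {{nCk≢0 k≤n}})

  nCk*[n∸k]Ct≡0 : ∀ {n k t} → n < k + t → (n C k) * ((n ∸ k) C t) ≡ 0
  nCk*[n∸k]Ct≡0 {n} {k} {t} n<k+t with ≤-<-connex k n
  ... | inj₂ n<k = cong (_* ((n ∸ k) C t)) (k>n⇒nCk≡0 n<k)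
  ... | inj₁ k≤n = trans (cong ((n C k) *_) (k>n⇒nCk≡0 n∸k<t)) (*-zeroʳ (n C k))
    where
    n∸k<t : n ∸ k < t
    n∸k<t = subst (n ∸ k <_) (m+n∸m≡n k t) (∸-monoˡ-< n<k+t k≤n)

  [k+t]Ck*nC[k+t]≡nCk*[n∸k]Ct : ∀ n k t → ((k + t) C k) * (n C (k + t)) ≡ (n C k) * ((n ∸ k) C t)
  [k+t]Ck*nC[k+t]≡nCk*[n∸k]Ct n k t with ≤-<-connex (k + t) n
  ... | inj₂ n<k+t = begin
    ((k + t) C k) * (n C (k + t))   ≡⟨ cong (((k + t) C k) *_) (k>n⇒nCk≡0 n<k+t) ⟩
    ((k + t) C k) * 0               ≡⟨ *-zeroʳ ((k + t) C k) ⟩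
    0                               ≡⟨ nCk*[n∸k]Ct≡0 {n} {k} {t} n<k+t ⟨
    (n C k) * ((n ∸ k) C t)         ∎
  ... | inj₁ k+t≤n =
    subst (λ n → ((k + t) C k) * (n C (k + t)) ≡ (n C k) * ((n ∸ k) C t)) k+[t+r]≡n (split (n ∸ (k + t)))
    where
    k+[t+r]≡n : k + (t + (n ∸ (k + t))) ≡ n
    k+[t+r]≡n = trans (sym (+-assoc k t _)) (m+[n∸m]≡n k+t≤n)

    rearrangeˡ : ∀ a b x u v → a * b * (x * (u * v)) ≡ b * (a * (x * u) * v)
    rearrangeˡ = solve-∀
    rearrangeʳ : ∀ c d x u v → c * (x * (d * (u * v))) ≡ c * d * (x * (u * v))
    rearrangeʳ = solve-∀

    -- Both sides count the ways to split k + t + r into blocks of sizes k, t and r.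
    split : ∀ r → ((k + t) C k) * ((k + (t + r)) C (k + t)) ≡ ((k + (t + r)) C k) * (((k + (t + r)) ∸ k) C t)
    split r = *-cancelʳ-≡ _ _ (k ! * (t ! * r !)) {{m*n≢0 (k !) _ {{k !≢0}} {{t !* r !≢0}}}} (begin
      ((k + t) C k) * (y C (k + t)) * (k ! * (t ! * r !))
        ≡⟨ rearrangeˡ ((k + t) C k) (y C (k + t)) (k !) (t !) (r !) ⟩
      (y C (k + t)) * (((k + t) C k) * (k ! * t !) * r !)
        ≡⟨ cong (λ z → (y C (k + t)) * (z * r !)) ([k+r]Ck*k!r!≡[k+r]! k t) ⟩
      (y C (k + t)) * ((k + t) ! * r !)
        ≡⟨ subst (λ y → (y C (k + t)) * ((k + t) ! * r !) ≡ y !) (+-assoc k t r)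
                 ([k+r]Ck*k!r!≡[k+r]! (k + t) r) ⟩
      y !
        ≡⟨ [k+r]Ck*k!r!≡[k+r]! k (t + r) ⟨
      (y C k) * (k ! * (t + r) !)
        ≡⟨ cong (λ z → (y C k) * (k ! * z)) ([k+r]Ck*k!r!≡[k+r]! t r) ⟨
      (y C k) * (k ! * (((t + r) C t) * (t ! * r !)))
        ≡⟨ cong (λ s → (y C k) * (k ! * ((s C t) * (t ! * r !)))) (m+n∸m≡n k (t + r)) ⟨
      (y C k) * (k ! * (((y ∸ k) C t) * (t ! * r !)))
        ≡⟨ rearrangeʳ (y C k) ((y ∸ k) C t) (k !) (t !) (r !) ⟩
      (y C k) * ((y ∸ k) C t) * (k ! * (t ! * r !)) ∎)
      where y = k + (t + r)

  nCm*[n∸m]Ch≡nCh*[n∸h]Cm : ∀ n m h → (n C m) * ((n ∸ m) C h) ≡ (n C h) * ((n ∸ h) C m)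
  nCm*[n∸m]Ch≡nCh*[n∸h]Cm n m h = begin
    (n C m) * ((n ∸ m) C h)         ≡⟨ [k+t]Ck*nC[k+t]≡nCk*[n∸k]Ct n m h ⟨
    ((m + h) C m) * (n C (m + h))   ≡⟨ cong (_* (n C (m + h))) [m+h]Cm≡[m+h]Ch ⟩
    ((m + h) C h) * (n C (m + h))   ≡⟨ cong (λ s → (s C h) * (n C s)) (+-comm m h) ⟩
    ((h + m) C h) * (n C (h + m))   ≡⟨ [k+t]Ck*nC[k+t]≡nCk*[n∸k]Ct n h m ⟩
    (n C h) * ((n ∸ h) C m)         ∎
    where
    [m+h]Cm≡[m+h]Ch : (m + h) C m ≡ (m + h) C h
    [m+h]Cm≡[m+h]Ch = trans (nCk≡nC[n∸k] (m≤m+n m h)) (cong ((m + h) C_) (m+n∸m≡n m h))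

  [n∸m]Pk*nCm≡[n∸k]Cm*nPk : ∀ n m k → ((n ∸ m) P k) * (n C m) ≡ ((n ∸ k) C m) * (n P k)
  [n∸m]Pk*nCm≡[n∸k]Cm*nPk n m k = begin
    ((n ∸ m) P k) * (n C m)           ≡⟨ cong (_* (n C m)) (nPk≡k!*nCk (n ∸ m) k) ⟩
    k ! * ((n ∸ m) C k) * (n C m)     ≡⟨ rearrange (k !) ((n ∸ m) C k) (n C m) ⟩
    k ! * ((n C m) * ((n ∸ m) C k))   ≡⟨ cong (k ! *_) (nCm*[n∸m]Ch≡nCh*[n∸h]Cm n m k) ⟩
    k ! * ((n C k) * ((n ∸ k) C m))   ≡⟨ rearrange′ (k !) (n C k) ((n ∸ k) C m) ⟩
    ((n ∸ k) C m) * (k ! * (n C k))   ≡⟨ cong (((n ∸ k) C m) *_) (nPk≡k!*nCk n k) ⟨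
    ((n ∸ k) C m) * (n P k)           ∎
    where
    rearrange : ∀ x a b → x * a * b ≡ x * (b * a)
    rearrange = solve-∀
    rearrange′ : ∀ x a b → x * (a * b) ≡ b * (x * a)
    rearrange′ = solve-∀

module Fractions where

  open import Data.Nat as ℕ using (ℕ; suc; NonZero)
  import Data.Nat.Properties as ℕ
  open import Data.Nat.ListAction using (product)
  open import Data.Nat.ListAction.Properties using (product≢0)
  open import Data.Integer as ℤ using (+_)
  import Data.Integer.Properties as ℤ
  open import Data.Rational using (ℚ; 0ℚ; 1ℚ; _+_; _*_; toℚᵘ)
  open import Data.Rational.Properties
  open import Data.Rational.Unnormalised as ℚᵘ using (mkℚᵘ; *≡*)
  import Data.Rational.Unnormalised.Properties as ℚᵘ
  open import Relation.Nullary using (Dec; yes; no)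
  open import Relation.Binary.PropositionalEquality
  open import Relation.Binary.Reasoning.Setoid ℚᵘ.≃-setoid using (begin_; step-≈-⟩; step-≈-⟨; _∎)

  toℚᵘ-frac : ∀ a d → toℚᵘ (frac a (suc d)) ℚᵘ.≃ mkℚᵘ (+ a) d
  toℚᵘ-frac a d = toℚᵘ-fromℚᵘ (mkℚᵘ (+ a) d)

  nat-+ : ∀ a b → nat (a ℕ.+ b) ≡ nat a + nat b
  nat-+ a b = toℚᵘ-injective (begin
    toℚᵘ (nat (a ℕ.+ b))             ≈⟨ toℚᵘ-frac (a ℕ.+ b) 0 ⟩
    mkℚᵘ (+ (a ℕ.+ b)) 0             ≈⟨ *≡* (cong (ℤ._* + 1) +[a+b]≡+a*1++b*1) ⟩
    mkℚᵘ (+ a) 0 ℚᵘ.+ mkℚᵘ (+ b) 0   ≈⟨ ℚᵘ.+-cong (toℚᵘ-frac a 0) (toℚᵘ-frac b 0) ⟨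
    toℚᵘ (nat a) ℚᵘ.+ toℚᵘ (nat b)   ≈⟨ toℚᵘ-homo-+ (nat a) (nat b) ⟨
    toℚᵘ (nat a + nat b)             ∎)
    where
    +[a+b]≡+a*1++b*1 : + (a ℕ.+ b) ≡ + a ℤ.* + 1 ℤ.+ + b ℤ.* + 1
    +[a+b]≡+a*1++b*1 = trans (ℤ.pos-+ a b) (sym (cong₂ ℤ._+_ (ℤ.*-identityʳ (+ a)) (ℤ.*-identityʳ (+ b))))

  frac-*-frac : ∀ a {b} c {d} .{{_ : NonZero b}} .{{_ : NonZero d}} →
                frac a b * frac c d ≡ frac (a ℕ.* c) (b ℕ.* d)
  frac-*-frac a {suc b} c {suc d} = toℚᵘ-injective (begin
    toℚᵘ (frac a (suc b) * frac c (suc d))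
      ≈⟨ toℚᵘ-homo-* (frac a (suc b)) (frac c (suc d)) ⟩
    toℚᵘ (frac a (suc b)) ℚᵘ.* toℚᵘ (frac c (suc d))
      ≈⟨ ℚᵘ.*-cong (toℚᵘ-frac a b) (toℚᵘ-frac c d) ⟩
    mkℚᵘ (+ a) b ℚᵘ.* mkℚᵘ (+ c) d
      ≈⟨ *≡* (cong (ℤ._* + (suc b ℕ.* suc d)) (sym (ℤ.pos-* a c))) ⟩
    mkℚᵘ (+ (a ℕ.* c)) (d ℕ.+ b ℕ.* suc d)
      ≈⟨ toℚᵘ-frac (a ℕ.* c) (d ℕ.+ b ℕ.* suc d) ⟨
    toℚᵘ (frac (a ℕ.* c) (suc b ℕ.* suc d)) ∎)

  nat-* : ∀ a b → nat (a ℕ.* b) ≡ nat a * nat b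
  nat-* a b = sym (frac-*-frac a {1} b {1})

  nat-*-frac : ∀ a c {d} .{{_ : NonZero d}} → nat a * frac c d ≡ frac (a ℕ.* c) d
  nat-*-frac a c {d} = trans (frac-*-frac a {1} c {d}) (cong (frac (a ℕ.* c)) (ℕ.*-identityˡ d))

  frac≡nat*frac1 : ∀ a {d} .{{_ : NonZero d}} → frac a d ≡ nat a * frac 1 d
  frac≡nat*frac1 a {d} = trans (cong (λ x → frac x d) (sym (ℕ.*-identityʳ a))) (sym (nat-*-frac a 1))

  frac-cross : ∀ a {b} c {d} .{{_ : NonZero b}} .{{_ : NonZero d}} →
               a ℕ.* d ≡ c ℕ.* b → frac a b ≡ frac c d
  frac-cross a {suc b} c {suc d} ad≡cb = toℚᵘ-injective (begin
    toℚᵘ (frac a (suc b))   ≈⟨ toℚᵘ-frac a b ⟩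
    mkℚᵘ (+ a) b            ≈⟨ *≡* (trans (sym (ℤ.pos-* a (suc d))) (trans (cong +_ ad≡cb) (ℤ.pos-* c (suc b)))) ⟩
    mkℚᵘ (+ c) d            ≈⟨ toℚᵘ-frac c d ⟨
    toℚᵘ (frac c (suc d))   ∎)

  prodℚ-frac : ∀ (f g : ℕ → ℕ) {xs} → All NonZero (map g xs) →
               prodℚ (map (λ x → frac (f x) (g x)) xs) ≡ frac (product (map f xs)) (product (map g xs))
  prodℚ-frac f g {[]}     []              = refl
  prodℚ-frac f g {x ∷ xs} (gx≢0 ∷ gxs≢0) = trans
    (cong (frac (f x) (g x) *_) (prodℚ-frac f g gxs≢0))
    (frac-*-frac (f x) (product (map f xs)) {{gx≢0}} {{product≢0 gxs≢0}})

  prodℚ-cong-All : ∀ {f g : ℕ → ℚ} {xs} → All (λ x → f x ≡ g x) xs → prodℚ (map f xs) ≡ prodℚ (map g xs)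
  prodℚ-cong-All []            = refl
  prodℚ-cong-All (fx≡gx ∷ eqs) = cong₂ _*_ fx≡gx (prodℚ-cong-All eqs)

  nat-∑ : ∀ {a} {A : Set a} (xs : List A) f → nat (∑ℕ.∑ xs f) ≡ ∑ℚ.∑ xs (λ x → nat (f x))
  nat-∑ []       f = refl
  nat-∑ (x ∷ xs) f = trans (nat-+ (f x) _) (cong (λ s → nat (f x) + s) (nat-∑ xs f))

  -- Matching on the Dec, rather than branching on does, keeps 𝟙 (n ≟ k) stuck,
  -- so that a later 'with n ≟ k' can abstract over it.
  𝟙 : ∀ {p} {P : Set p} → Dec P → ℚ
  𝟙 (yes _) = 1ℚ
  𝟙 (no _)  = 0ℚ

  nat-length-filter : ∀ {a p} {A : Set a} {P : Pred A p} (P? : Decidable P) xs →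
                      nat (length (filter P? xs)) ≡ ∑ℚ.∑ xs (λ x → 𝟙 (P? x))
  nat-length-filter P? []       = refl
  nat-length-filter P? (x ∷ xs) with P? x
  ... | yes _ = trans (nat-+ 1 (length (filter P? xs))) (cong (λ s → 1ℚ + s) (nat-length-filter P? xs))
  ... | no _  = trans (nat-length-filter P? xs) (sym (+-identityˡ _))

module BinomialInversion where

  open import Data.Nat as ℕ using (ℕ; zero; suc; _∸_; _<_; _≟_; NonZero)
  import Data.Nat.Properties as ℕ
  open import Data.Nat.Combinatorics using (_C_; nCk+nC[k+1]≡[n+1]C[k+1]; nCn≡1)
  open import Data.Nat.Combinatorics.Specification using (k>n⇒nCk≡0)
  open import Data.Rational using (ℚ; 0ℚ; 1ℚ; _+_; _*_; -_)
  open import Data.Rational.Properties hiding (_≟_)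
  open import Data.Rational.Solver using (module +-*-Solver)
  open import Data.List using ([_]; _++_; map; upTo; applyUpTo)
  open import Data.List.Properties using (upTo-∷ʳ; map-applyUpTo)
  open import Algebra.Bundles using (CommutativeMonoid)
  open import Algebra.Properties.CommutativeSemigroup
    (CommutativeMonoid.commutativeSemigroup *-1-commutativeMonoid) using (x∙yz≈y∙xz)
  open import Relation.Nullary using (yes; no)
  open import Relation.Binary.PropositionalEquality using (_≡_; refl; sym; trans; cong; module ≡-Reasoning)
  open ≡-Reasoning
  open +-*-Solver using (solve; _:=_; _:*_; _:+_; :-_)
  open ∑ℚ
  open Fractions
  open Binomial using ([k+t]Ck*nC[k+t]≡nCk*[n∸k]Ct)

  ∑-upTo-suc : ∀ L f → ∑ (upTo (suc L)) f ≡ f 0 + ∑ (upTo L) (λ t → f (suc t))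
  ∑-upTo-suc L f = cong (f 0 +_) (begin
    ∑ (applyUpTo suc L) f          ≡⟨ cong (λ xs → ∑ xs f) (map-applyUpTo (λ t → t) suc L) ⟨
    ∑ (map suc (upTo L)) f         ≡⟨ ∑-map suc (upTo L) f ⟩
    ∑ (upTo L) (λ t → f (suc t))   ∎)

  ∑-upTo-∷ʳ : ∀ L f → ∑ (upTo (suc L)) f ≡ ∑ (upTo L) f + f L
  ∑-upTo-∷ʳ L f = begin
    ∑ (upTo (suc L)) f          ≡⟨ cong (λ xs → ∑ xs f) (upTo-∷ʳ L) ⟨
    ∑ (upTo L ++ [ L ]) f       ≡⟨ ∑-++ (upTo L) [ L ] f ⟩
    ∑ (upTo L) f + (f L + 0ℚ)   ≡⟨ cong (∑ (upTo L) f +_) (+-identityʳ (f L)) ⟩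
    ∑ (upTo L) f + f L          ∎

  ∑-alternating-[1+a]C : ∀ a L →
    ∑ (upTo (suc L)) (λ t → negOnePow t * nat (suc a C t)) ≡ negOnePow L * nat (a C L)
  ∑-alternating-[1+a]C a zero    = +-identityʳ (1ℚ * 1ℚ)
  ∑-alternating-[1+a]C a (suc L) = begin
    ∑ (upTo (suc (suc L))) f                                  ≡⟨ ∑-upTo-∷ʳ (suc L) f ⟩
    ∑ (upTo (suc L)) f + f (suc L)                            ≡⟨ cong (_+ f (suc L)) (∑-alternating-[1+a]C a L) ⟩
    s * nat (a C L) + - s * nat (suc a C suc L)               ≡⟨ cong (λ x → s * nat (a C L) + - s * x) pascal ⟩
    s * nat (a C L) + - s * (nat (a C L) + nat (a C suc L))   ≡⟨ telescope s (nat (a C L)) (nat (a C suc L)) ⟩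
    - s * nat (a C suc L)                                     ∎
    where
    f = λ t → negOnePow t * nat (suc a C t)
    s = negOnePow L
    pascal : nat (suc a C suc L) ≡ nat (a C L) + nat (a C suc L)
    pascal = trans (cong nat (sym (nCk+nC[k+1]≡[n+1]C[k+1] a L))) (nat-+ (a C L) (a C suc L))
    telescope : ∀ s x y → s * x + - s * (x + y) ≡ - s * y
    telescope = solve 3 (λ s x y → s :* x :+ (:- s) :* (x :+ y) := (:- s) :* y) refl

  ∑-alternating-C : ∀ a L → a < L → ∑ (upTo L) (λ t → negOnePow t * nat (a C t)) ≡ 𝟙 (a ≟ 0)
  ∑-alternating-C zero    (suc L) _           = begin
    ∑ (upTo (suc L)) (λ t → negOnePow t * nat (0 C t))
      ≡⟨ ∑-upTo-suc L (λ t → negOnePow t * nat (0 C t)) ⟩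
    1ℚ * 1ℚ + ∑ (upTo L) (λ t → - negOnePow t * 0ℚ)
      ≡⟨ cong (1ℚ +_) (∑-cong (upTo L) (λ t → *-zeroʳ (- negOnePow t))) ⟩
    1ℚ + ∑ (upTo L) (λ _ → 0ℚ)
      ≡⟨ cong (1ℚ +_) (∑-zero (upTo L)) ⟩
    1ℚ ∎
  ∑-alternating-C (suc a) (suc L) (ℕ.s≤s a<L) = begin
    ∑ (upTo (suc L)) (λ t → negOnePow t * nat (suc a C t))   ≡⟨ ∑-alternating-[1+a]C a L ⟩
    negOnePow L * nat (a C L)                                 ≡⟨ cong (λ x → negOnePow L * nat x) (k>n⇒nCk≡0 a<L) ⟩
    negOnePow L * 0ℚ                                          ≡⟨ *-zeroʳ (negOnePow L) ⟩
    0ℚ                                                        ∎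

  nCk*[n∸k≟0]≡[n≟k] : ∀ n k → nat (n C k) * 𝟙 (n ∸ k ≟ 0) ≡ 𝟙 (n ≟ k)
  nCk*[n∸k≟0]≡[n≟k] n k with n ≟ k
  ... | yes refl rewrite nCn≡1 n | ℕ.n∸n≡0 n = refl
  ... | no n≢k with n ∸ k ≟ 0
  ...   | yes n∸k≡0 = cong (λ x → nat x * 1ℚ) (k>n⇒nCk≡0 (ℕ.≤∧≢⇒< (ℕ.m∸n≡0⇒m≤n n∸k≡0) n≢k))
  ...   | no _      = *-zeroʳ (nat (n C k))

  [n≟k]≡∑-alternating : ∀ n k L .{{_ : NonZero L}} → n < k ℕ.+ L →
    𝟙 (n ≟ k) ≡ ∑ (upTo L) (λ t → negOnePow t * nat ((k ℕ.+ t) C k) * nat (n C (k ℕ.+ t)))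
  [n≟k]≡∑-alternating n k L n<k+L = sym (begin
    ∑ (upTo L) (λ t → negOnePow t * nat ((k ℕ.+ t) C k) * nat (n C (k ℕ.+ t)))
      ≡⟨ ∑-cong (upTo L) factor ⟩
    ∑ (upTo L) (λ t → nat (n C k) * (negOnePow t * nat ((n ∸ k) C t)))
      ≡⟨ *-distribˡ-∑ (nat (n C k)) (upTo L) _ ⟨
    nat (n C k) * ∑ (upTo L) (λ t → negOnePow t * nat ((n ∸ k) C t))
      ≡⟨ cong (nat (n C k) *_) (∑-alternating-C (n ∸ k) L (ℕ.m<n+o⇒m∸n<o n k n<k+L)) ⟩
    nat (n C k) * 𝟙 (n ∸ k ≟ 0)
      ≡⟨ nCk*[n∸k≟0]≡[n≟k] n k ⟩
    𝟙 (n ≟ k) ∎)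
    where
    factor : ∀ t → negOnePow t * nat ((k ℕ.+ t) C k) * nat (n C (k ℕ.+ t))
                 ≡ nat (n C k) * (negOnePow t * nat ((n ∸ k) C t))
    factor t = begin
      s * nat ((k ℕ.+ t) C k) * nat (n C (k ℕ.+ t))     ≡⟨ *-assoc s _ _ ⟩
      s * (nat ((k ℕ.+ t) C k) * nat (n C (k ℕ.+ t)))   ≡⟨ cong (s *_) (nat-* ((k ℕ.+ t) C k) (n C (k ℕ.+ t))) ⟨
      s * nat (((k ℕ.+ t) C k) ℕ.* (n C (k ℕ.+ t)))     ≡⟨ cong (λ x → s * nat x) ([k+t]Ck*nC[k+t]≡nCk*[n∸k]Ct n k t) ⟩
      s * nat ((n C k) ℕ.* ((n ∸ k) C t))               ≡⟨ cong (s *_) (nat-* (n C k) ((n ∸ k) C t)) ⟩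
      s * (nat (n C k) * nat ((n ∸ k) C t))             ≡⟨ x∙yz≈y∙xz s (nat (n C k)) (nat ((n ∸ k) C t)) ⟩
      nat (n C k) * (s * nat ((n ∸ k) C t))             ∎
      where s = negOnePow t

module SubsetCounting where

  open import Data.Nat
  open import Data.Nat.Properties
  open import Data.Nat.Combinatorics using (_C_; _P_; nCk+nC[k+1]≡[n+1]C[k+1])
  open import Data.Nat.ListAction using (product)
  import Data.List.Relation.Unary.All as All
  open import Data.List.Relation.Unary.All.Properties using (all-filter)
  open import Data.Vec using (Vec; []; _∷_; toList)
  open import Data.Fin.Subset using (Subset; ∣_∣; ⋃; _∪_; ⊥)
  open import Data.Fin.Subset.Properties using (∣p∣≤n; ∣⊥∣≡0)
  open import Relation.Binary.PropositionalEquality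
  open ≡-Reasoning
  open ∑ℕ
  open Binomial using (nPk≡k!*nCk)

  ∑-const : ∀ {a} {A : Set a} (xs : List A) c → ∑ xs (λ _ → c) ≡ length xs * c
  ∑-const []       c = refl
  ∑-const (x ∷ xs) c = cong (c +_) (∑-const xs c)

  𝟙-disjoint : ∀ {n} → Subset n → Subset n → ℕ
  𝟙-disjoint []          []          = 1
  𝟙-disjoint (true ∷ T)  (true ∷ A)  = 0
  𝟙-disjoint (true ∷ T)  (false ∷ A) = 𝟙-disjoint T A
  𝟙-disjoint (false ∷ T) (_ ∷ A)     = 𝟙-disjoint T A

  𝟙-disjoint-comm : ∀ {n} (T A : Subset n) → 𝟙-disjoint T A ≡ 𝟙-disjoint A T
  𝟙-disjoint-comm []          []          = refl
  𝟙-disjoint-comm (true ∷ T)  (true ∷ A)  = refl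
  𝟙-disjoint-comm (true ∷ T)  (false ∷ A) = 𝟙-disjoint-comm T A
  𝟙-disjoint-comm (false ∷ T) (true ∷ A)  = 𝟙-disjoint-comm T A
  𝟙-disjoint-comm (false ∷ T) (false ∷ A) = 𝟙-disjoint-comm T A

  𝟙-disjoint-⊥ : ∀ {n} (T : Subset n) → 𝟙-disjoint T ⊥ ≡ 1
  𝟙-disjoint-⊥ []          = refl
  𝟙-disjoint-⊥ (true ∷ T)  = 𝟙-disjoint-⊥ T
  𝟙-disjoint-⊥ (false ∷ T) = 𝟙-disjoint-⊥ T

  𝟙-disjoint-∪ : ∀ {n} (T A B : Subset n) → 𝟙-disjoint T (A ∪ B) ≡ 𝟙-disjoint T A * 𝟙-disjoint T B
  𝟙-disjoint-∪ []          []          []          = refl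
  𝟙-disjoint-∪ (true ∷ T)  (true ∷ A)  (b ∷ B)     = refl
  𝟙-disjoint-∪ (true ∷ T)  (false ∷ A) (true ∷ B)  = sym (*-zeroʳ (𝟙-disjoint T A))
  𝟙-disjoint-∪ (true ∷ T)  (false ∷ A) (false ∷ B) = 𝟙-disjoint-∪ T A B
  𝟙-disjoint-∪ (false ∷ T) (a ∷ A)     (b ∷ B)     = 𝟙-disjoint-∪ T A B

  𝟙-disjoint-of-size : ∀ {n} → ℕ → Subset n → Subset n → ℕ
  𝟙-disjoint-of-size m T A = if does (∣ A ∣ ≟ m) then 𝟙-disjoint T A else 0

  ∑-𝟙-disjoint-of-size : ∀ n m (T : Subset n) → ∑ (allSubsets n) (𝟙-disjoint-of-size m T) ≡ (n ∸ ∣ T ∣) C m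
  ∑-𝟙-disjoint-of-size zero    zero    []          = refl
  ∑-𝟙-disjoint-of-size zero    (suc m) []          = refl
  ∑-𝟙-disjoint-of-size (suc n) m       (true ∷ T)  = begin
    ∑ (allSubsets (suc n)) (𝟙-disjoint-of-size m (true ∷ T))
      ≡⟨ ∑-concatMap _ (allSubsets n) _ ⟩
    ∑ (allSubsets n) (λ A → (if does (suc ∣ A ∣ ≟ m) then 0 else 0) + (𝟙-disjoint-of-size m T A + 0))
      ≡⟨ ∑-cong (allSubsets n) (λ A → cong₂ _+_ (if-then-0-else-0 (does (suc ∣ A ∣ ≟ m))) (+-identityʳ _)) ⟩
    ∑ (allSubsets n) (𝟙-disjoint-of-size m T)
      ≡⟨ ∑-𝟙-disjoint-of-size n m T ⟩
    (n ∸ ∣ T ∣) C m ∎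
    where
    if-then-0-else-0 : ∀ b → (if b then 0 else 0) ≡ 0
    if-then-0-else-0 true  = refl
    if-then-0-else-0 false = refl
  ∑-𝟙-disjoint-of-size (suc n) zero    (false ∷ T) = begin
    ∑ (allSubsets (suc n)) (𝟙-disjoint-of-size zero (false ∷ T))
      ≡⟨ ∑-concatMap _ (allSubsets n) _ ⟩
    ∑ (allSubsets n) (λ A → 𝟙-disjoint-of-size zero T A + 0)
      ≡⟨ ∑-cong (allSubsets n) (λ A → +-identityʳ _) ⟩
    ∑ (allSubsets n) (𝟙-disjoint-of-size zero T)
      ≡⟨ ∑-𝟙-disjoint-of-size n zero T ⟩
    1 ∎
  ∑-𝟙-disjoint-of-size (suc n) (suc m) (false ∷ T) = begin
    ∑ (allSubsets (suc n)) (𝟙-disjoint-of-size (suc m) (false ∷ T))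
      ≡⟨ ∑-concatMap _ (allSubsets n) _ ⟩
    ∑ (allSubsets n) (λ A → 𝟙-disjoint-of-size m T A + (𝟙-disjoint-of-size (suc m) T A + 0))
      ≡⟨ ∑-cong (allSubsets n) (λ A → cong (𝟙-disjoint-of-size m T A +_) (+-identityʳ _)) ⟩
    ∑ (allSubsets n) (λ A → 𝟙-disjoint-of-size m T A + 𝟙-disjoint-of-size (suc m) T A)
      ≡⟨ ∑-distrib-+ (allSubsets n) (𝟙-disjoint-of-size m T) (𝟙-disjoint-of-size (suc m) T) ⟩
    ∑ (allSubsets n) (𝟙-disjoint-of-size m T) + ∑ (allSubsets n) (𝟙-disjoint-of-size (suc m) T)
      ≡⟨ cong₂ _+_ (∑-𝟙-disjoint-of-size n m T) (∑-𝟙-disjoint-of-size n (suc m) T) ⟩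
    (n ∸ ∣ T ∣) C m + (n ∸ ∣ T ∣) C suc m
      ≡⟨ nCk+nC[k+1]≡[n+1]C[k+1] (n ∸ ∣ T ∣) m ⟩
    suc (n ∸ ∣ T ∣) C suc m
      ≡⟨ cong (_C suc m) (+-∸-assoc 1 (∣p∣≤n T)) ⟨
    (suc n ∸ ∣ T ∣) C suc m ∎

  ∑-𝟙-disjoint-kSubsets : ∀ n m (T : Subset n) → ∑ (kSubsets n m) (𝟙-disjoint T) ≡ (n ∸ ∣ T ∣) C m
  ∑-𝟙-disjoint-kSubsets n m T =
    trans (∑-filter (λ A → ∣ A ∣ ≟ m) (allSubsets n) (𝟙-disjoint T)) (∑-𝟙-disjoint-of-size n m T)

  length≡∑𝟙-disjoint-⊥ : ∀ {a} {A : Set a} {n} (xs : List A) (f : A → Subset n) →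
                         length xs ≡ ∑ xs (λ x → 𝟙-disjoint ⊥ (f x))
  length≡∑𝟙-disjoint-⊥ xs f = begin
    length xs                         ≡⟨ *-identityʳ (length xs) ⟨
    length xs * 1                     ≡⟨ ∑-const xs 1 ⟨
    ∑ xs (λ _ → 1)                    ≡⟨ ∑-cong xs (λ x → trans (sym (𝟙-disjoint-⊥ (f x)))
                                                                (𝟙-disjoint-comm (f x) ⊥)) ⟩
    ∑ xs (λ x → 𝟙-disjoint ⊥ (f x))   ∎

  length-kSubsets : ∀ n m → length (kSubsets n m) ≡ n C m
  length-kSubsets n m = begin
    length (kSubsets n m)             ≡⟨ length≡∑𝟙-disjoint-⊥ (kSubsets n m) (λ A → A) ⟩
    ∑ (kSubsets n m) (𝟙-disjoint ⊥)   ≡⟨ ∑-𝟙-disjoint-kSubsets n m ⊥ ⟩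
    (n ∸ ∣ ⊥ {n = n} ∣) C m           ≡⟨ cong (λ s → (n ∸ s) C m) (∣⊥∣≡0 n) ⟩
    n C m                             ∎

  ∑-kSubsets-size : ∀ n h (g : ℕ → ℕ) → ∑ (kSubsets n h) (λ T → g ∣ T ∣) ≡ (n C h) * g h
  ∑-kSubsets-size n h g = begin
    ∑ (kSubsets n h) (λ T → g ∣ T ∣)
      ≡⟨ ∑-cong-All (All.map (cong g) (all-filter (λ T → ∣ T ∣ ≟ h) (allSubsets n))) ⟩
    ∑ (kSubsets n h) (λ _ → g h)
      ≡⟨ ∑-const (kSubsets n h) (g h) ⟩
    length (kSubsets n h) * g h
      ≡⟨ cong (_* g h) (length-kSubsets n h) ⟩
    (n C h) * g h ∎

  module _ (n : ℕ) where

    private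
      ⋃ᵛ : ∀ {ℓ} → Vec (Subset n) ℓ → Subset n
      ⋃ᵛ As = ⋃ (toList As)

    ∑-𝟙-disjoint-outcomes : ∀ {ℓ} (ms : Vec ℕ ℓ) (T : Subset n) →
      ∑ (outcomes n ms) (λ As → 𝟙-disjoint T (⋃ᵛ As)) ≡ product (map ((n ∸ ∣ T ∣) C_) (toList ms))
    ∑-𝟙-disjoint-outcomes []       T = trans (+-identityʳ _) (𝟙-disjoint-⊥ T)
    ∑-𝟙-disjoint-outcomes (m ∷ ms) T = begin
      ∑ (outcomes n (m ∷ ms)) (λ As → 𝟙-disjoint T (⋃ᵛ As))
        ≡⟨ ∑-concatMap _ (kSubsets n m) _ ⟩
      ∑ (kSubsets n m) (λ A → ∑ (map (A ∷_) (outcomes n ms)) (λ As → 𝟙-disjoint T (⋃ᵛ As)))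
        ≡⟨ ∑-cong (kSubsets n m) prepend ⟩
      ∑ (kSubsets n m) (λ A → 𝟙-disjoint T A * Π)
        ≡⟨ *-distribʳ-∑ Π (kSubsets n m) (𝟙-disjoint T) ⟨
      ∑ (kSubsets n m) (𝟙-disjoint T) * Π
        ≡⟨ cong (_* Π) (∑-𝟙-disjoint-kSubsets n m T) ⟩
      ((n ∸ ∣ T ∣) C m) * Π ∎
      where
      Π = product (map ((n ∸ ∣ T ∣) C_) (toList ms))
      prepend : ∀ A → ∑ (map (A ∷_) (outcomes n ms)) (λ As → 𝟙-disjoint T (⋃ᵛ As)) ≡ 𝟙-disjoint T A * Π
      prepend A = begin
        ∑ (map (A ∷_) (outcomes n ms)) (λ As → 𝟙-disjoint T (⋃ᵛ As))
          ≡⟨ ∑-map (A ∷_) (outcomes n ms) _ ⟩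
        ∑ (outcomes n ms) (λ As → 𝟙-disjoint T (A ∪ ⋃ᵛ As))
          ≡⟨ ∑-cong (outcomes n ms) (λ As → 𝟙-disjoint-∪ T A (⋃ᵛ As)) ⟩
        ∑ (outcomes n ms) (λ As → 𝟙-disjoint T A * 𝟙-disjoint T (⋃ᵛ As))
          ≡⟨ *-distribˡ-∑ (𝟙-disjoint T A) (outcomes n ms) _ ⟨
        𝟙-disjoint T A * ∑ (outcomes n ms) (λ As → 𝟙-disjoint T (⋃ᵛ As))
          ≡⟨ cong (𝟙-disjoint T A *_) (∑-𝟙-disjoint-outcomes ms T) ⟩
        𝟙-disjoint T A * Π ∎

    length-outcomes : ∀ {ℓ} (ms : Vec ℕ ℓ) → length (outcomes n ms) ≡ product (map (n C_) (toList ms))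
    length-outcomes ms = begin
      length (outcomes n ms)
        ≡⟨ length≡∑𝟙-disjoint-⊥ (outcomes n ms) ⋃ᵛ ⟩
      ∑ (outcomes n ms) (λ As → 𝟙-disjoint ⊥ (⋃ᵛ As))
        ≡⟨ ∑-𝟙-disjoint-outcomes ms ⊥ ⟩
      product (map ((n ∸ ∣ ⊥ {n = n} ∣) C_) (toList ms))
        ≡⟨ cong (λ s → product (map ((n ∸ s) C_) (toList ms))) (∣⊥∣≡0 n) ⟩
      product (map (n C_) (toList ms)) ∎

    ∑-binomial-moment : ∀ {ℓ} (ms : Vec ℕ ℓ) h →
      ∑ (outcomes n ms) (λ As → Yvar As C h) ≡ (n C h) * product (map ((n ∸ h) C_) (toList ms))
    ∑-binomial-moment ms h = begin
      ∑ Ω (λ As → (n ∸ ∣ ⋃ᵛ As ∣) C h)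
        ≡⟨ ∑-cong Ω (λ As → ∑-𝟙-disjoint-kSubsets n h (⋃ᵛ As)) ⟨
      ∑ Ω (λ As → ∑ (kSubsets n h) (𝟙-disjoint (⋃ᵛ As)))
        ≡⟨ ∑-comm Ω (kSubsets n h) (λ As → 𝟙-disjoint (⋃ᵛ As)) ⟩
      ∑ (kSubsets n h) (λ T → ∑ Ω (λ As → 𝟙-disjoint (⋃ᵛ As) T))
        ≡⟨ ∑-cong (kSubsets n h) (λ T → trans (∑-cong Ω (λ As → 𝟙-disjoint-comm (⋃ᵛ As) T))
                                               (∑-𝟙-disjoint-outcomes ms T)) ⟩
      ∑ (kSubsets n h) (λ T → product (map ((n ∸ ∣ T ∣) C_) (toList ms)))
        ≡⟨ ∑-kSubsets-size n h (λ s → product (map ((n ∸ s) C_) (toList ms))) ⟩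
      (n C h) * product (map ((n ∸ h) C_) (toList ms)) ∎
      where Ω = outcomes n ms

    ∑-factorial-moment : ∀ {ℓ} (ms : Vec ℕ ℓ) k →
      ∑ (outcomes n ms) (λ As → Yvar As P k) ≡ (n P k) * product (map ((n ∸ k) C_) (toList ms))
    ∑-factorial-moment ms k = begin
      ∑ Ω (λ As → Yvar As P k)           ≡⟨ ∑-cong Ω (λ As → nPk≡k!*nCk (Yvar As) k) ⟩
      ∑ Ω (λ As → k ! * (Yvar As C k))   ≡⟨ *-distribˡ-∑ (k !) Ω _ ⟨
      k ! * ∑ Ω (λ As → Yvar As C k)     ≡⟨ cong (k ! *_) (∑-binomial-moment ms k) ⟩
      k ! * ((n C k) * Π)                ≡⟨ *-assoc (k !) (n C k) Π ⟨
      k ! * (n C k) * Π                  ≡⟨ cong (_* Π) (nPk≡k!*nCk n k) ⟨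
      (n P k) * Π                        ∎
      where
      Ω = outcomes n ms
      Π = product (map ((n ∸ k) C_) (toList ms))

open import Data.Nat as ℕ using (ℕ; suc; _≤_; _<_; _∸_; _≟_; NonZero)
open import Data.Nat.Combinatorics using (_C_; _P_; nCk≡nC[n∸k])
open import Data.Nat.Combinatorics.Specification using (k>n⇒nPk≡0)
open import Data.Nat.ListAction using (product)
open import Data.Nat.ListAction.Properties using (product≢0)
open import Data.Rational using (ℚ; 0ℚ; _+_; _*_)
open import Data.Rational.Properties using (*-zeroˡ; *-assoc)
open import Data.Rational.Solver using (module +-*-Solver)
open import Data.List using (upTo)
open import Data.List.Properties using (filter-≐)
import Data.List.Relation.Unary.All as All
open import Data.List.Relation.Unary.All.Properties using (map⁺; all-upTo)
open import Data.Vec using (Vec; toList; lookup)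
open import Data.Vec.Relation.Unary.All.Properties using (lookup⁻; toList⁺)
open import Data.Fin using (Fin)
open import Data.Fin.Subset using (⋃)
open import Data.Fin.Subset.Properties using (∣p∣≤n)
open import Data.Product using (_×_; _,_)
open import Data.Sum using (inj₁; inj₂)
open import Relation.Unary using (_≐_)
open import Relation.Binary.PropositionalEquality
  using (_≡_; refl; sym; trans; cong; cong₂; subst; module ≡-Reasoning)
open ≡-Reasoning
open +-*-Solver using (solve; _:=_; _:*_)
open ∑ℚ
open Binomial
open Fractions
open BinomialInversion using ([n≟k]≡∑-alternating)
open SubsetCounting

module _ (n : ℕ) {ℓ} (ms : Vec ℕ ℓ) (ms≤n : All (_≤ n) (toList ms)) where

  private
    Ω = outcomes n ms
    D = product (map (n C_) (toList ms))

    Π : ℕ → ℕ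
    Π h = product (map ((n ∸ h) C_) (toList ms))

    instance
      D≢0 : NonZero D
      D≢0 = product≢0 (map⁺ (All.map nCk≢0 ms≤n))

  -- The probability that a fixed h-subset of 𝒩 is disjoint from every A_j.
  avoid-prob : ℕ → ℚ
  avoid-prob h = prodℚ (map (λ m → frac ((n ∸ h) C m) (n C m)) (toList ms))

  frac-Π≡avoid-prob : ∀ h → frac (Π h) D ≡ avoid-prob h
  frac-Π≡avoid-prob h = sym (prodℚ-frac ((n ∸ h) C_) (n C_) (map⁺ (All.map nCk≢0 ms≤n)))

  avoid-prob≡∏-P-ratio : ∀ {h} → h ≤ n →
    avoid-prob h ≡ prodℚ (map (λ m → frac ((n ∸ m) P h) (n P h)) (toList ms))
  avoid-prob≡∏-P-ratio {h} h≤n = prodℚ-cong-All (All.map C-ratio≡P-ratio ms≤n)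
    where
    C-ratio≡P-ratio : ∀ {m} → m ≤ n → frac ((n ∸ h) C m) (n C m) ≡ frac ((n ∸ m) P h) (n P h)
    C-ratio≡P-ratio {m} m≤n =
      frac-cross _ _ {{nCk≢0 m≤n}} {{nPk≢0 h≤n}} (sym ([n∸m]Pk*nCm≡[n∸k]Cm*nPk n m h))

  E-falling-Y≡nPk*avoid-prob : ∀ k → E Ω (λ As → Yvar As P k) ≡ nat (n P k) * avoid-prob k
  E-falling-Y≡nPk*avoid-prob k = begin
    E Ω (λ As → Yvar As P k)        ≡⟨ cong₂ frac (∑-factorial-moment n ms k) (length-outcomes n ms) ⟩
    frac ((n P k) ℕ.* Π k) D        ≡⟨ nat-*-frac (n P k) (Π k) ⟨
    nat (n P k) * frac (Π k) D      ≡⟨ cong (nat (n P k) *_) (frac-Π≡avoid-prob k) ⟩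
    nat (n P k) * avoid-prob k      ∎

  nat-count-Y≡∑-alternating : ∀ k → nat (length (filter (λ As → Yvar As ≟ k) Ω)) ≡
    ∑ (upTo (suc (n ∸ k))) (λ t → negOnePow t * nat ((k ℕ.+ t) C k) * nat ((n C (k ℕ.+ t)) ℕ.* Π (k ℕ.+ t)))
  nat-count-Y≡∑-alternating k = begin
    nat (length (filter (λ As → Yvar As ≟ k) Ω))
      ≡⟨ nat-length-filter (λ As → Yvar As ≟ k) Ω ⟩
    ∑ Ω (λ As → 𝟙 (Yvar As ≟ k))
      ≡⟨ ∑-cong Ω (λ As → [n≟k]≡∑-alternating (Yvar As) k (suc (n ∸ k)) (Y<k+L As)) ⟩
    ∑ Ω (λ As → ∑ R (λ t → c t * nat (Yvar As C (k ℕ.+ t))))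
      ≡⟨ ∑-comm Ω R _ ⟩
    ∑ R (λ t → ∑ Ω (λ As → c t * nat (Yvar As C (k ℕ.+ t))))
      ≡⟨ ∑-cong R (λ t → *-distribˡ-∑ (c t) Ω _) ⟨
    ∑ R (λ t → c t * ∑ Ω (λ As → nat (Yvar As C (k ℕ.+ t))))
      ≡⟨ ∑-cong R (λ t → cong (c t *_) (nat-∑ Ω (λ As → Yvar As C (k ℕ.+ t)))) ⟨
    ∑ R (λ t → c t * nat (∑ℕ.∑ Ω (λ As → Yvar As C (k ℕ.+ t))))
      ≡⟨ ∑-cong R (λ t → cong (λ x → c t * nat x) (∑-binomial-moment n ms (k ℕ.+ t))) ⟩
    ∑ R (λ t → c t * nat ((n C (k ℕ.+ t)) ℕ.* Π (k ℕ.+ t))) ∎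
    where
    R = upTo (suc (n ∸ k))
    c : ℕ → ℚ
    c t = negOnePow t * nat ((k ℕ.+ t) C k)
    Y<k+L : ∀ As → Yvar As < k ℕ.+ suc (n ∸ k)
    Y<k+L As = subst (Yvar As <_) (sym (ℕ.+-suc k (n ∸ k)))
                     (ℕ.s≤s (ℕ.≤-trans (ℕ.m∸n≤m n (Xvar As)) (ℕ.m≤n+m∸n n k)))

  Pr-Y≡∑avoid-prob : ∀ k → Pr= Ω Yvar k ≡
    ∑ (upTo (suc (n ∸ k))) (λ t → negOnePow t * nat ((k ℕ.+ t) C k) * nat (n C (k ℕ.+ t)) * avoid-prob (k ℕ.+ t))
  Pr-Y≡∑avoid-prob k = begin
    frac #[Y≡k] (length Ω)
      ≡⟨ cong (frac #[Y≡k]) (length-outcomes n ms) ⟩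
    frac #[Y≡k] D
      ≡⟨ frac≡nat*frac1 #[Y≡k] ⟩
    nat #[Y≡k] * frac 1 D
      ≡⟨ cong (_* frac 1 D) (nat-count-Y≡∑-alternating k) ⟩
    ∑ R (λ t → c t * nat ((n C (k ℕ.+ t)) ℕ.* Π (k ℕ.+ t))) * frac 1 D
      ≡⟨ *-distribʳ-∑ (frac 1 D) R (λ t → c t * nat ((n C (k ℕ.+ t)) ℕ.* Π (k ℕ.+ t))) ⟩
    ∑ R (λ t → c t * nat ((n C (k ℕ.+ t)) ℕ.* Π (k ℕ.+ t)) * frac 1 D)
      ≡⟨ ∑-cong R divide ⟩
    ∑ R (λ t → c t * nat (n C (k ℕ.+ t)) * avoid-prob (k ℕ.+ t)) ∎
    where
    #[Y≡k] = length (filter (λ As → Yvar As ≟ k) Ω)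
    R = upTo (suc (n ∸ k))
    c : ℕ → ℚ
    c t = negOnePow t * nat ((k ℕ.+ t) C k)
    divide : ∀ t → c t * nat ((n C (k ℕ.+ t)) ℕ.* Π (k ℕ.+ t)) * frac 1 D
                 ≡ c t * nat (n C (k ℕ.+ t)) * avoid-prob (k ℕ.+ t)
    divide t = begin
      c t * nat (a ℕ.* Π h) * frac 1 D       ≡⟨ cong (λ x → c t * x * frac 1 D) (nat-* a (Π h)) ⟩
      c t * (nat a * nat (Π h)) * frac 1 D   ≡⟨ cong (_* frac 1 D) (*-assoc (c t) (nat a) (nat (Π h))) ⟨
      c t * nat a * nat (Π h) * frac 1 D     ≡⟨ *-assoc (c t * nat a) (nat (Π h)) (frac 1 D) ⟩
      c t * nat a * (nat (Π h) * frac 1 D)   ≡⟨ cong (c t * nat a *_) (sym (frac≡nat*frac1 (Π h))) ⟩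
      c t * nat a * frac (Π h) D             ≡⟨ cong (c t * nat a *_) (frac-Π≡avoid-prob h) ⟩
      c t * nat a * avoid-prob h             ∎
      where
      h = k ℕ.+ t
      a = n C h

  Pr-X≡Pr-Y : ∀ {i} → i ≤ n → Pr= Ω Xvar i ≡ Pr= Ω Yvar (n ∸ i)
  Pr-X≡Pr-Y {i} i≤n =
    cong (λ xs → frac (length xs) (length Ω)) (filter-≐ (λ As → Xvar As ≟ i) (λ As → Yvar As ≟ n ∸ i) X≐Y Ω)
    where
    X≐Y : (λ As → Xvar As ≡ i) ≐ (λ As → Yvar As ≡ n ∸ i)
    X≐Y = cong (n ∸_) , λ {As} → ℕ.∸-cancelˡ-≡ (∣p∣≤n (⋃ (toList As))) i≤n

  E-falling-Y : ∀ k →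
    E Ω (λ As → ff (Yvar As) k) ≡ nat (ff n k) * prodℚ (map (λ m → frac (ff (n ∸ m) k) (ff n k)) (toList ms))
  E-falling-Y k with ℕ.≤-<-connex k n
  ... | inj₁ k≤n = trans (E-falling-Y≡nPk*avoid-prob k) (cong (nat (n P k) *_) (avoid-prob≡∏-P-ratio k≤n))
  ... | inj₂ n<k = begin
    E Ω (λ As → Yvar As P k)     ≡⟨ E-falling-Y≡nPk*avoid-prob k ⟩
    nat (n P k) * avoid-prob k   ≡⟨ cong (λ x → nat x * avoid-prob k) (k>n⇒nPk≡0 n<k) ⟩
    0ℚ * avoid-prob k            ≡⟨ *-zeroˡ (avoid-prob k) ⟩
    0ℚ                           ≡⟨ *-zeroˡ ∏-P-ratio ⟨
    0ℚ * ∏-P-ratio               ≡⟨ cong (λ x → nat x * ∏-P-ratio) (k>n⇒nPk≡0 n<k) ⟨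
    nat (n P k) * ∏-P-ratio      ∎
    where ∏-P-ratio = prodℚ (map (λ m → frac ((n ∸ m) P k) (n P k)) (toList ms))

  Pr-Y : ∀ k → k ≤ n → Pr= Ω Yvar k ≡ sumFromTo k n (λ h → negOnePow (h ∸ k) * nat (h C k) * nat (n C h)
                                                         * prodℚ (map (λ m → frac (ff (n ∸ m) h) (ff n h)) (toList ms)))
  Pr-Y k k≤n = begin
    Pr= Ω Yvar k
      ≡⟨ Pr-Y≡∑avoid-prob k ⟩
    ∑ (upTo (suc (n ∸ k))) term
      ≡⟨ cong (λ L → ∑ (upTo L) term) (ℕ.+-∸-assoc 1 k≤n) ⟨
    ∑ (upTo (suc n ∸ k)) term
      ≡⟨ ∑-cong-All (All.map convert (all-upTo (suc n ∸ k))) ⟩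
    ∑ (upTo (suc n ∸ k)) (λ t → f (k ℕ.+ t)) ∎
    where
    term : ℕ → ℚ
    term t = negOnePow t * nat ((k ℕ.+ t) C k) * nat (n C (k ℕ.+ t)) * avoid-prob (k ℕ.+ t)
    f : ℕ → ℚ
    f h = negOnePow (h ∸ k) * nat (h C k) * nat (n C h) * prodℚ (map (λ m → frac ((n ∸ m) P h) (n P h)) (toList ms))
    convert : ∀ {t} → t < suc n ∸ k → term t ≡ f (k ℕ.+ t)
    convert {t} t<L = cong₂ (λ e x → negOnePow e * nat ((k ℕ.+ t) C k) * nat (n C (k ℕ.+ t)) * x)
                            (sym (ℕ.m+n∸m≡n k t)) (avoid-prob≡∏-P-ratio k+t≤n)
      where
      k+t≤n : k ℕ.+ t ≤ n
      k+t≤n = ℕ.≤-pred (subst (k ℕ.+ t <_) (ℕ.m+[n∸m]≡n (ℕ.m≤n⇒m≤1+n k≤n)) (ℕ.+-monoʳ-< k t<L))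

  Pr-X : ∀ i → i ≤ n → Pr= Ω Xvar i ≡ nat (n C i) * sumFromTo 0 i (λ h → negOnePow h * nat (i C h)
                                                    * prodℚ (map (λ m → frac ((i ∸ h) C m) (n C m)) (toList ms)))
  Pr-X i i≤n = begin
    Pr= Ω Xvar i                                 ≡⟨ Pr-X≡Pr-Y i≤n ⟩
    Pr= Ω Yvar k                                 ≡⟨ Pr-Y≡∑avoid-prob k ⟩
    ∑ (upTo (suc (n ∸ k))) term                  ≡⟨ cong (λ L → ∑ (upTo (suc L)) term) (ℕ.m∸[m∸n]≡n i≤n) ⟩
    ∑ (upTo (suc i)) term                        ≡⟨ ∑-cong (upTo (suc i)) reindex ⟩
    ∑ (upTo (suc i)) (λ t → nat (n C i) * g t)   ≡⟨ *-distribˡ-∑ (nat (n C i)) (upTo (suc i)) g ⟨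
    nat (n C i) * ∑ (upTo (suc i)) g             ∎
    where
    k = n ∸ i
    term : ℕ → ℚ
    term t = negOnePow t * nat ((k ℕ.+ t) C k) * nat (n C (k ℕ.+ t)) * avoid-prob (k ℕ.+ t)
    g : ℕ → ℚ
    g t = negOnePow t * nat (i C t) * prodℚ (map (λ m → frac ((i ∸ t) C m) (n C m)) (toList ms))
    n∸[k+t]≡i∸t : ∀ t → n ∸ (k ℕ.+ t) ≡ i ∸ t
    n∸[k+t]≡i∸t t = trans (sym (ℕ.∸-+-assoc n k t)) (cong (_∸ t) (ℕ.m∸[m∸n]≡n i≤n))
    choose : ∀ t → nat ((k ℕ.+ t) C k) * nat (n C (k ℕ.+ t)) ≡ nat (n C i) * nat (i C t)
    choose t = begin
      nat ((k ℕ.+ t) C k) * nat (n C (k ℕ.+ t))   ≡⟨ nat-* ((k ℕ.+ t) C k) (n C (k ℕ.+ t)) ⟨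
      nat (((k ℕ.+ t) C k) ℕ.* (n C (k ℕ.+ t)))   ≡⟨ cong nat ([k+t]Ck*nC[k+t]≡nCk*[n∸k]Ct n k t) ⟩
      nat ((n C k) ℕ.* ((n ∸ k) C t))             ≡⟨ cong₂ (λ a b → nat (a ℕ.* (b C t)))
                                                           (sym (nCk≡nC[n∸k] i≤n)) (ℕ.m∸[m∸n]≡n i≤n) ⟩
      nat ((n C i) ℕ.* (i C t))                   ≡⟨ nat-* (n C i) (i C t) ⟩
      nat (n C i) * nat (i C t)                   ∎
    reindex : ∀ t → term t ≡ nat (n C i) * g t
    reindex t = begin
      s * a * b * avoid-prob (k ℕ.+ t)       ≡⟨ cong (λ e → s * a * b * prodℚ (map (λ m → frac (e C m) (n C m)) (toList ms)))
                                                     (n∸[k+t]≡i∸t t) ⟩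
      s * a * b * q                          ≡⟨ cong (_* q) (*-assoc s a b) ⟩
      s * (a * b) * q                        ≡⟨ cong (λ x → s * x * q) (choose t) ⟩
      s * (nat (n C i) * nat (i C t)) * q    ≡⟨ shuffle s (nat (n C i)) (nat (i C t)) q ⟩
      nat (n C i) * g t                      ∎
      where
      s = negOnePow t
      a = nat ((k ℕ.+ t) C k)
      b = nat (n C (k ℕ.+ t))
      q = prodℚ (map (λ m → frac ((i ∸ t) C m) (n C m)) (toList ms))
      shuffle : ∀ s x y q → s * (x * y) * q ≡ x * (s * y * q)
      shuffle = solve 4 (λ s x y q → s :* (x :* y) :* q := x :* (s :* y :* q)) refl

lemma5p2 : (n ℓ : ℕ) → 0 < n → 0 < ℓ → (m : Vec ℕ ℓ) → ((j : Fin ℓ) → lookup m j ≤ n) →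
    ((k : ℕ) →
      E (outcomes n m) (λ As → ff (Yvar As) k)
        ≡ nat (ff n k) * prodℚ (map (λ mj → frac (ff (n ∸ mj) k) (ff n k)) (toList m)))
    × ((k : ℕ) → k ≤ n →
      Pr= (outcomes n m) Yvar k
        ≡ sumFromTo k n (λ h → negOnePow (h ∸ k) * nat (h C k) * nat (n C h)
               * prodℚ (map (λ mj → frac (ff (n ∸ mj) h) (ff n h)) (toList m))))
    × ((i : ℕ) → i ≤ n →
      Pr= (outcomes n m) Xvar i
        ≡ nat (n C i) * sumFromTo 0 i (λ h → negOnePow h * nat (i C h)
               * prodℚ (map (λ mj → frac ((i ∸ h) C mj) (n C mj)) (toList m))))
lemma5p2 n ℓ _ _ m m≤n = E-falling-Y n m ms≤n , Pr-Y n m ms≤n , Pr-X n m ms≤n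
  where
  ms≤n : All (_≤ n) (toList m)
  ms≤n = toList⁺ (lookup⁻ m≤n)
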